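{- Let $i\geq 1$ be an integer and $G$ an $(i,i)$-critical multigraph. For every partition $V(G)=A\sqcup B$ with $A\neq\emptyset$ and $B\neq\emptyset$, there is $v\in B$ such that $(i+1)d_A(v)+d_B(v)\geq 2i+2$, where for $X\subseteq V(G)$, $d_X(v)$ denotes the number of edges of $G$ joining $v$ to vertices of $X$.
   Context: Multigraphs are finite without loops. A 2-fold cover of a multigraph $G$ is a pair $(L,\mathcal H)$ where $\mathcal H$ is a graph and $L$ assigns to each $v\in V(G)$ a 2-element set $L(v)=\{p(v),r(v)\}$ such that the sets $L(v)$ partition $V(\mathcal H)$, $p(v)r(v)\in E(\mathcal H)$, edges of $\mathcal H$ between $L(u)$ and $L(v)$ ($u\ne v$) exist only if $uv\in E(G)$, and if $u,v$ are joined by $k\ge1$ edges then $\mathcal H[L(u),L(v)]$ is a union of at most $k$ perfect matchings between $L(u)$ and $L(v)$. An $\mathcal H$-map is a function $\phi$ with $\phi(v)\in L(v)$; $\mathcal H_\phi$ is the subgraph induced by $\phi(V(G))$. An $(i,i)$-coloring is an $\mathcal H$-map $\phi$ with all degrees in $\mathcal H_\phi$ at most $i$. $G$ is $(i,i)$-critical if some 2-fold cover of $G$ has no $(i,i)$-coloring while every 2-fold cover of every proper subgraph of $G$ has one. -}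

module Defs where

open import Data.Nat using (ℕ; zero; suc; _+_; _*_; _≤_; _<_)
open import Data.Fin using (Fin; zero; suc)
open import Data.Bool using (Bool; true; false; if_then_else_; _xor_; not)
open import Data.Product using (Σ; ∃; _×_; _,_)
open import Data.Sum using (_⊎_)
open import Data.List using (List; length)
open import Data.List.Membership.Propositional using (_∈_)
open import Relation.Binary.PropositionalEquality using (_≡_)
open import Relation.Nullary using (¬_)
open import Function using (_⇔_)
open import Function.Definitions using (Injective)

sumFin : (n : ℕ) → (Fin n → ℕ) → ℕ
sumFin zero    f = 0
sumFin (suc n) f = f zero + sumFin n (λ u → f (suc u))

record Multigraph : Set where
  field
    size     : ℕ
    mult     : Fin size → Fin size → ℕ
    mult-sym : ∀ u v → mult u v ≡ mult v u
    loopless : ∀ v → mult v v ≡ 0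
open Multigraph public

record Subgraph (G : Multigraph) : Set where
  field
    sub      : Multigraph
    emb      : Fin (size sub) → Fin (size G)
    emb-inj  : Injective _≡_ _≡_ emb
    emb-mult : ∀ u v → mult sub u v ≤ mult G (emb u) (emb v)
open Subgraph public

Proper : {G : Multigraph} → Subgraph G → Set
Proper {G} S = (size (sub S) < size G)
             ⊎ (∃ λ u → ∃ λ v → mult (sub S) u v < mult G (emb S u) (emb S v))

-- V(𝓗) = Fin n × Bool, L(v) = {(v,false),(v,true)}
-- (p(v) = (v,false), r(v) = (v,true)).  𝓗 is a simple graph given by a
-- symmetric irreflexive Bool-valued adjacency.  A perfect matching between
-- L(u) and L(v) is {(u,a)(v, a xor t) | a} for a twist t : Bool.
record Cover (G : Multigraph) : Set where
  field
    adj      : Fin (size G) × Bool → Fin (size G) × Bool → Bool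
    adj-sym  : ∀ x y → adj x y ≡ adj y x
    adj-irr  : ∀ x → adj x x ≡ false
    adj-pr   : ∀ v → adj (v , false) (v , true) ≡ true
    -- for u ≠ v, 𝓗[L(u),L(v)] is a union of at most mult u v perfect matchings
    adj-match : ∀ u v → ¬ (u ≡ v) →
      Σ (List Bool) λ ts → (length ts ≤ mult G u v) ×
        (∀ a b → (adj (u , a) (v , b) ≡ true) ⇔ (Σ Bool λ t → (t ∈ ts) × (b ≡ a xor t)))
open Cover public

-- An 𝓗-map φ picks φ(v) = (v , φ v) ∈ L(v).  Degree of φ(v) in 𝓗_φ.
degφ : {G : Multigraph} → Cover G → (Fin (size G) → Bool) → Fin (size G) → ℕ
degφ {G} C φ v = sumFin (size G) (λ u → if adj C (v , φ v) (u , φ u) then 1 else 0)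

IsColoring : (i : ℕ) → {G : Multigraph} → Cover G → (Fin (size G) → Bool) → Set
IsColoring i {G} C φ = ∀ v → degφ C φ v ≤ i

HasColoring : (i : ℕ) → {G : Multigraph} → Cover G → Set
HasColoring i {G} C = Σ (Fin (size G) → Bool) λ φ → IsColoring i C φ

Critical : (i : ℕ) → Multigraph → Set
Critical i G =
  (Σ (Cover G) λ C → ¬ HasColoring i C) ×
  (∀ (S : Subgraph G) → Proper S → ∀ (C : Cover (sub S)) → HasColoring i C)

dIn : (G : Multigraph) → (Fin (size G) → Bool) → Fin (size G) → ℕ
dIn G X v = sumFin (size G) (λ u → if X u then mult G v u else 0)

Complement : {n : ℕ} → (Fin n → Bool) → (Fin n → Bool)
Complement X u = not (X u)

module Submission where

-- Let B = V(G) ∖ A, and suppose that every v ∈ B is light, i.e.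
-- (i+1)·d_A(v) + d_B(v) ≤ 2i+1.  We show that then every 2-fold cover C of G
-- has an (i,i)-colouring, contradicting the criticality of G.
--
-- 1. Let G[A] keep all vertices but only the edges inside A.  Proper
--    subgraphs of G[A] are proper subgraphs of G, so their covers are
--    colourable; in particular so is the restriction of C to G[A] − b for
--    some b ∈ B.  As b is isolated in G[A], the colouring extends over b,
--    giving a colouring ψ of the restriction C[A] of C to G[A].
-- 2. Keep ψ on A and recolour B by local search for the potential
--    P(φ) = Σ_{x,y} w(x,y)·[φ(x)φ(y) ∈ E(𝓗)], with weights w = 0 inside A,
--    i+1 between A and B and 1 inside B.  Flipping v ∈ B changes P by twice
--    the change of the weighted degree c_φ(v) of φ(v), so P strictly drops
--    while some flip lowers c_φ(v) at some v ∈ B.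
-- 3. At a local optimum c_φ(v) + c_φ(v) ≤ c_φ(v) + c_{φ'}(v) ≤ (i+1)d_A(v) + d_B(v)
--    for v ∈ B (φ' = φ flipped at v), so c_φ(v) ≤ i: B-vertices have degree
--    ≤ i and see no A-vertex, and A-vertices have the same degree as under ψ.

open import Defs
open import Data.Bool using (Bool; true; false; not; if_then_else_; _∧_; _∨_; _xor_)
open import Data.Bool.Properties using (∧-comm; ∧-identityʳ; ∧-zeroʳ; ∨-zeroʳ) renaming (_≟_ to _≟ᵇ_)
open import Data.Empty using (⊥-elim)
open import Data.Fin using (Fin; zero; suc; punchIn; punchOut)
open import Data.Fin.Properties using (punchInᵢ≢i; punchIn-injective; punchIn-punchOut; injective⇒≤; any?)
  renaming (_≟_ to _≟ᶠ_)
open import Data.List using (List; []; length)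
open import Data.List.Membership.Propositional using (_∈_)
open import Data.List.Membership.Propositional.Properties using (∈-length)
open import Data.List.Relation.Unary.Any using (here; there)
open import Data.Nat
open import Data.Nat.Properties
open import Data.Nat.Solver using (module +-*-Solver)
open import Data.Product using (Σ; ∃; _×_; _,_; proj₁; proj₂)
open import Data.Sum using (inj₁; inj₂)
open import Data.Vec.Functional using (insertAt; updateAt)
open import Data.Vec.Functional.Properties using (insertAt-punchIn; updateAt-updates; updateAt-minimal)
open import Function using (_∘_; _⇔_; mk⇔; Equivalence)
open import Relation.Binary.PropositionalEquality
open import Relation.Nullary using (yes; no; does)
open import Relation.Nullary.Decidable using (_×-dec_; dec-true)
open import Algebra.Properties.Semiring.Sum +-*-semiring
  using (sum; sum-cong-≗; sum-remove; ∑-distrib-+; *-distribˡ-sum; sum-replicate-zero)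

false≢true : false ≢ true
false≢true ()

exchange : ∀ {a b c d} → a + (b + b) ≡ c + (d + d) → b < d → c < a
exchange {a} {b} {c} {d} eq b<d with c <? a
... | yes c<a = c<a
... | no c≮a  = ⊥-elim (<-irrefl eq (+-mono-≤-< (≮⇒≥ c≮a) (+-mono-< b<d b<d)))

half : ∀ i r → r + r < 2 * i + 2 → r ≤ i
half i r r+r< with r ≤? i
... | yes r≤i = r≤i
... | no r≰i = ⊥-elim (<⇒≱ r+r< (subst (_≤ r + r) double (+-mono-≤ (≰⇒> r≰i) (≰⇒> r≰i))))
  where
    open +-*-Solver
    double : suc i + suc i ≡ 2 * i + 2
    double = solve 1 (λ j → (con 1 :+ j) :+ (con 1 :+ j) := con 2 :* j :+ con 2) refl i

ind : Bool → ℕ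
ind b = if b then 1 else 0

sumFin≡sum : ∀ n (f : Fin n → ℕ) → sumFin n f ≡ sum f
sumFin≡sum zero    f = refl
sumFin≡sum (suc n) f = cong (f zero +_) (sumFin≡sum n (f ∘ suc))

sumFin-cong : ∀ n {f g : Fin n → ℕ} → (∀ u → f u ≡ g u) → sumFin n f ≡ sumFin n g
sumFin-cong n {f} {g} f≗g =
  trans (sumFin≡sum n f) (trans (sum-cong-≗ f≗g) (sym (sumFin≡sum n g)))

sumFin-+ : ∀ n (f g : Fin n → ℕ) → sumFin n (λ u → f u + g u) ≡ sumFin n f + sumFin n g
sumFin-+ n f g = trans (sumFin≡sum n _)
  (trans (∑-distrib-+ f g) (sym (cong₂ _+_ (sumFin≡sum n f) (sumFin≡sum n g))))

sumFin-scale : ∀ n c (f : Fin n → ℕ) → c * sumFin n f ≡ sumFin n (λ u → c * f u)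
sumFin-scale n c f = trans (cong (c *_) (sumFin≡sum n f))
  (trans (*-distribˡ-sum c f) (sym (sumFin≡sum n _)))

sumFin-zero : ∀ n (f : Fin n → ℕ) → (∀ u → f u ≡ 0) → sumFin n f ≡ 0
sumFin-zero n f f≗0 = trans (sumFin-cong n f≗0)
  (trans (sumFin≡sum n (λ _ → 0)) (sum-replicate-zero n))

sumFin-mono : ∀ n {f g : Fin n → ℕ} → (∀ u → f u ≤ g u) → sumFin n f ≤ sumFin n g
sumFin-mono zero    f≤g = z≤n
sumFin-mono (suc n) f≤g = +-mono-≤ (f≤g zero) (sumFin-mono n (f≤g ∘ suc))


-- The number of points left, and the order-preserving embedding that
-- misses b (the library's `punchIn`, available once n is a successor).
shrink : (n : ℕ) → Fin n → ℕ
shrink (suc m) _ = m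

skip : ∀ {n} (b : Fin n) → Fin (shrink n b) → Fin n
skip {suc m} b = punchIn b

skip≢ : ∀ {n} (b : Fin n) u → skip b u ≢ b
skip≢ {suc m} b = punchInᵢ≢i b

skip-injective : ∀ {n} (b : Fin n) {u u′} → skip b u ≡ skip b u′ → u ≡ u′
skip-injective {suc m} b = punchIn-injective b _ _

skip-onto : ∀ {n} (b x : Fin n) → x ≢ b → ∃ λ u → skip b u ≡ x
skip-onto {suc m} b x x≢b = punchOut (x≢b ∘ sym) , punchIn-punchOut (x≢b ∘ sym)

shrink< : ∀ {n} (b : Fin n) → shrink n b < n
shrink< {suc m} b = ≤-refl

sumFin-skip : ∀ {n} (b : Fin n) (f : Fin n → ℕ) →
  sumFin n f ≡ f b + sumFin (shrink n b) (f ∘ skip b)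
sumFin-skip {suc m} b f = trans (sumFin≡sum (suc m) f)
  (trans (sum-remove {i = b} f) (cong (f b +_) (sym (sumFin≡sum m _))))

term≤sumFin : ∀ n (f : Fin n → ℕ) u → f u ≤ sumFin n f
term≤sumFin n f u = subst (f u ≤_) (sym (sumFin-skip u f)) (m≤m+n _ _)

fill : ∀ {n} {X : Set} (b : Fin n) → X → (Fin (shrink n b) → X) → Fin n → X
fill {suc m} b x f = insertAt f b x

fill-skip : ∀ {n} {X : Set} (b : Fin n) (x : X) f u → fill b x f (skip b u) ≡ f u
fill-skip {suc m} b x f = insertAt-punchIn f b x


total : ∀ n → (Fin n → Fin n → ℕ) → ℕ
total n H = sumFin n (λ x → sumFin n (H x))

core : ∀ {n} → (Fin n → Fin n → ℕ) → (v : Fin n) → ℕ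
core {n} H v = total (shrink n v) (λ x y → H (skip v x) (skip v y))

total-split : ∀ n (H : Fin n → Fin n → ℕ) v → (∀ x y → H x y ≡ H y x) → H v v ≡ 0 →
  total n H ≡ sumFin n (H v) + (sumFin n (H v) + core H v)
total-split n H v H-sym Hvv≡0 = begin
  total n H
    ≡⟨ sumFin-skip v _ ⟩
  row v + sumFin m (λ x → sumFin n (H (skip v x)))
    ≡⟨ cong (row v +_) (sumFin-cong m (λ x → sumFin-skip v (H (skip v x)))) ⟩
  row v + sumFin m (λ x → H (skip v x) v + sumFin m (H (skip v x) ∘ skip v))
    ≡⟨ cong (row v +_) (sumFin-+ m _ _) ⟩
  row v + (sumFin m (λ x → H (skip v x) v) + core H v)
    ≡⟨ cong (λ s → row v + (s + core H v)) column≡row ⟩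
  row v + (row v + core H v) ∎
  where
    open ≡-Reasoning
    m : ℕ
    m = shrink n v
    row : Fin n → ℕ
    row x = sumFin n (H x)
    column≡row : sumFin m (λ x → H (skip v x) v) ≡ row v
    column≡row = begin
      sumFin m (λ x → H (skip v x) v)  ≡⟨ sumFin-cong m (λ x → H-sym (skip v x) v) ⟩
      sumFin m (H v ∘ skip v)          ≡⟨ cong (_+ sumFin m (H v ∘ skip v)) Hvv≡0 ⟨
      H v v + sumFin m (H v ∘ skip v)  ≡⟨ sumFin-skip v (H v) ⟨
      row v                            ∎

total-change : ∀ n (H H′ : Fin n → Fin n → ℕ) v →
  (∀ x y → H x y ≡ H y x) → (∀ x y → H′ x y ≡ H′ y x) → H v v ≡ 0 → H′ v v ≡ 0 →
  (∀ x y → x ≢ v → y ≢ v → H x y ≡ H′ x y) →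
  total n H + (sumFin n (H′ v) + sumFin n (H′ v)) ≡ total n H′ + (sumFin n (H v) + sumFin n (H v))
total-change n H H′ v H-sym H′-sym Hvv H′vv agree = begin
  total n H + (r′ + r′)             ≡⟨ cong (_+ (r′ + r′)) (total-split n H v H-sym Hvv) ⟩
  (r + (r + core H v)) + (r′ + r′)  ≡⟨ cong (λ k → (r + (r + k)) + (r′ + r′)) same-core ⟩
  (r + (r + k′)) + (r′ + r′)        ≡⟨ solve 3 (λ r r′ k → (r :+ (r :+ k)) :+ (r′ :+ r′) := (r′ :+ (r′ :+ k)) :+ (r :+ r))
                                         refl r r′ k′ ⟩
  (r′ + (r′ + k′)) + (r + r)        ≡⟨ cong (_+ (r + r)) (total-split n H′ v H′-sym H′vv) ⟨
  total n H′ + (r + r)              ∎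
  where
    open ≡-Reasoning
    r r′ k′ : ℕ
    r  = sumFin n (H v)
    r′ = sumFin n (H′ v)
    k′ = core H′ v
    open +-*-Solver
    same-core : core H v ≡ core H′ v
    same-core = sumFin-cong _ (λ x → sumFin-cong _ (λ y →
      agree (skip v x) (skip v y) (skip≢ v x) (skip≢ v y)))


twist : ∀ {G} (C : Cover G) {u v} (u≢v : u ≢ v) {a b} → adj C (u , a) (v , b) ≡ true →
  ∃ λ t → t ∈ proj₁ (adj-match C u v u≢v) × b ≡ a xor t
twist C u≢v {a} {b} = Equivalence.to (proj₂ (proj₂ (adj-match C _ _ u≢v)) a b)

distinct⇒2≤length : ∀ {t t′ : Bool} {ts : List Bool} → t ∈ ts → t′ ∈ ts → t ≢ t′ → 2 ≤ length ts
distinct⇒2≤length (here refl) (here refl) t≢t′ = ⊥-elim (t≢t′ refl)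
distinct⇒2≤length (here _)    (there q)   _    = s≤s (∈-length q)
distinct⇒2≤length (there p)   (here _)    _    = s≤s (∈-length p)
distinct⇒2≤length (there p)   (there q)   t≢t′ = m≤n⇒m≤1+n (distinct⇒2≤length p q t≢t′)

-- A lift (u , c) is adjacent to at most mult v u of the two lifts of v,
-- since each adjacent lift is reached through a different matching.
fibre-bound : ∀ {G} (C : Cover G) {u v} → u ≢ v → ∀ b c →
  ind (adj C (v , b) (u , c)) + ind (adj C (v , not b) (u , c)) ≤ mult G v u
fibre-bound {G} C {u} {v} u≢v b c
  rewrite adj-sym C (v , b) (u , c) | adj-sym C (v , not b) (u , c) | mult-sym G v u =
    ≤-trans (to-twists (adj C (u , c) (v , b)) (adj C (u , c) (v , not b)) refl refl)
            (proj₁ (proj₂ (adj-match C u v u≢v)))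
  where
    ts : List Bool
    ts = proj₁ (adj-match C u v u≢v)
    to-twists : ∀ x y → adj C (u , c) (v , b) ≡ x → adj C (u , c) (v , not b) ≡ y →
      ind x + ind y ≤ length ts
    to-twists false false _ _ = z≤n
    to-twists true  false e _ = ∈-length (proj₁ (proj₂ (twist C u≢v e)))
    to-twists false true  _ e = ∈-length (proj₁ (proj₂ (twist C u≢v e)))
    to-twists true  true  e e′ with twist C u≢v e | twist C u≢v e′
    ... | t , t∈ , b≡ | t′ , t′∈ , ¬b≡ = distinct⇒2≤length t∈ t′∈ (λ t≡t′ →
      not-≢ b (trans b≡ (trans (cong (c xor_) t≡t′) (sym ¬b≡))))
      where
        not-≢ : ∀ x → x ≢ not x
        not-≢ false ()
        not-≢ true  ()

isolated-no-adj : ∀ {G} (C : Cover G) {b y} → (∀ v → mult G b v ≡ 0) → y ≢ b → ∀ c c′ →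
  ind (adj C (b , c) (y , c′)) ≡ 0
isolated-no-adj {G} C {b} {y} b-isolated y≢b c c′ =
  n≤0⇒n≡0 (subst (ind (adj C (b , c) (y , c′)) ≤_) (b-isolated y)
    (m+n≤o⇒m≤o _ (fibre-bound C y≢b c c′)))


ProperlyColourable : ℕ → Multigraph → Set
ProperlyColourable i G = ∀ (S : Subgraph G) → Proper S → ∀ (C : Cover (sub S)) → HasColoring i C

compose : ∀ {G} (T : Subgraph G) → Subgraph (sub T) → Subgraph G
compose T S = record
  { sub      = sub S
  ; emb      = emb T ∘ emb S
  ; emb-inj  = emb-inj S ∘ emb-inj T
  ; emb-mult = λ u v → ≤-trans (emb-mult S u v) (emb-mult T (emb S u) (emb S v))
  }

compose-proper : ∀ {G} (T : Subgraph G) (S : Subgraph (sub T)) → Proper S → Proper (compose T S)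
compose-proper T S (inj₁ smaller) = inj₁ (<-≤-trans smaller (injective⇒≤ (emb-inj T)))
compose-proper T S (inj₂ (u , v , fewer)) =
  inj₂ (u , v , <-≤-trans fewer (emb-mult T (emb S u) (emb S v)))

ProperlyColourable-sub : ∀ {i G} → ProperlyColourable i G → (T : Subgraph G) → ProperlyColourable i (sub T)
ProperlyColourable-sub colourable T S proper = colourable (compose T S) (compose-proper T S proper)


module Deletion (G : Multigraph) (b : Fin (size G)) where

  G─b : Multigraph
  G─b = record
    { size     = shrink (size G) b
    ; mult     = λ u v → mult G (skip b u) (skip b v)
    ; mult-sym = λ u v → mult-sym G _ _
    ; loopless = λ v → loopless G _
    }

  deletion : Subgraph G
  deletion = record { sub = G─b ; emb = skip b ; emb-inj = skip-injective b ; emb-mult = λ u v → ≤-refl }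

  deletion-proper : Proper deletion
  deletion-proper = inj₁ (shrink< b)

  restrict : Cover G → Cover G─b
  restrict C = record
    { adj       = λ x y → adj C (skip b (proj₁ x) , proj₂ x) (skip b (proj₁ y) , proj₂ y)
    ; adj-sym   = λ x y → adj-sym C _ _
    ; adj-irr   = λ x → adj-irr C _
    ; adj-pr    = λ v → adj-pr C _
    ; adj-match = λ u v u≢v → adj-match C (skip b u) (skip b v) (u≢v ∘ skip-injective b)
    }

-- A colouring of C restricted to G − b extends to C when b is isolated:
-- colour b arbitrarily; it sees no other lift, so no degree changes.
colouring-extends : ∀ {i} (G : Multigraph) (b : Fin (size G)) → (∀ v → mult G b v ≡ 0) →
  ProperlyColourable i G → (C : Cover G) → HasColoring i C
colouring-extends {i} G b b-isolated colourable C = φ , φ-colouring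
  where
    open Deletion G b
    ψ-colouring : HasColoring i (restrict C)
    ψ-colouring = colourable deletion deletion-proper (restrict C)
    ψ : Fin (size G─b) → Bool
    ψ = proj₁ ψ-colouring
    φ : Fin (size G) → Bool
    φ = fill b false ψ
    deg-b : degφ C φ b ≡ 0
    deg-b = sumFin-zero (size G) _ edge-from-b
      where
        edge-from-b : ∀ y → ind (adj C (b , φ b) (y , φ y)) ≡ 0
        edge-from-b y with y ≟ᶠ b
        ... | yes refl = cong ind (adj-irr C _)
        ... | no y≢b   = isolated-no-adj C b-isolated y≢b _ _
    deg-skip : ∀ u → degφ C φ (skip b u) ≡ degφ (restrict C) ψ u
    deg-skip u = begin
      degφ C φ (skip b u)
        ≡⟨ sumFin-skip b _ ⟩
      ind (adj C (x , φ x) (b , φ b)) + degφ (restrict C) (φ ∘ skip b) u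
        ≡⟨ cong (_+ degφ (restrict C) (φ ∘ skip b) u) (trans (cong ind (adj-sym C _ _)) (isolated-no-adj C b-isolated (skip≢ b u) _ _)) ⟩
      degφ (restrict C) (φ ∘ skip b) u
        ≡⟨ sumFin-cong _ (λ u′ → cong₂ (λ p q → ind (adj C (x , p) (skip b u′ , q)))
                                   (fill-skip b false ψ u) (fill-skip b false ψ u′)) ⟩
      degφ (restrict C) ψ u ∎
      where
        open ≡-Reasoning
        x : Fin (size G)
        x = skip b u
    φ-colouring : IsColoring i C φ
    φ-colouring x with x ≟ᶠ b
    ... | yes refl = subst (_≤ i) (sym deg-b) z≤n
    ... | no x≢b with skip-onto b x x≢b
    ...   | u , refl = subst (_≤ i) (sym (deg-skip u)) (proj₂ ψ-colouring u)


module InsideA (G : Multigraph) (A : Fin (size G) → Bool) where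

  -- Pairs of vertices whose connections are kept: both in A, or equal
  -- (the latter keeps the edge p(v)r(v) of every fibre of a cover).
  kept : Fin (size G) → Fin (size G) → Bool
  kept u v = (A u ∧ A v) ∨ does (u ≟ᶠ v)

  kept-sym : ∀ u v → kept u v ≡ kept v u
  kept-sym u v rewrite ∧-comm (A u) (A v) with u ≟ᶠ v | v ≟ᶠ u
  ... | yes _   | yes _   = refl
  ... | no _    | no _    = refl
  ... | yes u≡v | no v≢u  = ⊥-elim (v≢u (sym u≡v))
  ... | no u≢v  | yes v≡u = ⊥-elim (u≢v (sym v≡u))

  multA : Fin (size G) → Fin (size G) → ℕ
  multA u v = if kept u v then mult G u v else 0

  G[A] : Multigraph
  G[A] = record
    { size     = size G
    ; mult     = multA
    ; mult-sym = λ u v → subst (λ k → multA u v ≡ (if k then mult G v u else 0)) (kept-sym u v)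
                           (cong (if kept u v then_else 0) (mult-sym G u v))
    ; loopless = multA-loopless
    }
    where
      multA-loopless : ∀ v → multA v v ≡ 0
      multA-loopless v with kept v v
      ... | true  = loopless G v
      ... | false = refl

  multA≤mult : ∀ u v → multA u v ≤ mult G u v
  multA≤mult u v with kept u v
  ... | true  = ≤-refl
  ... | false = z≤n

  inside : Subgraph G
  inside = record { sub = G[A] ; emb = λ u → u ; emb-inj = λ eq → eq ; emb-mult = multA≤mult }

  outside-isolated : ∀ {b} → A b ≡ false → ∀ v → multA b v ≡ 0
  outside-isolated {b} b∉A v rewrite b∉A with b ≟ᶠ v
  ... | yes refl = loopless G b
  ... | no _     = refl

  adjA : Cover G → Fin (size G) × Bool → Fin (size G) × Bool → Bool
  adjA C x y = adj C x y ∧ kept (proj₁ x) (proj₁ y)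

  restrictA : Cover G → Cover G[A]
  restrictA C = record
    { adj       = adjA C
    ; adj-sym   = λ x y → cong₂ _∧_ (adj-sym C x y) (kept-sym (proj₁ x) (proj₁ y))
    ; adj-irr   = λ x → cong (_∧ _) (adj-irr C x)
    ; adj-pr    = λ v → cong₂ _∧_ (adj-pr C v) (kept-refl v)
    ; adj-match = match
    }
    where
      kept-refl : ∀ v → kept v v ≡ true
      kept-refl v = trans (cong ((A v ∧ A v) ∨_) (dec-true (v ≟ᶠ v) refl)) (∨-zeroʳ (A v ∧ A v))
      match : ∀ u v → u ≢ v → Σ (List Bool) λ ts → (length ts ≤ multA u v) ×
        (∀ a b → (adjA C (u , a) (v , b) ≡ true) ⇔ (Σ Bool λ t → (t ∈ ts) × (b ≡ a xor t)))
      match u v u≢v with kept u v | adj-match C u v u≢v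
      ... | true  | ts , len , iff = ts , len , λ a b →
            subst (λ z → (z ≡ true) ⇔ _) (sym (∧-identityʳ _)) (iff a b)
      ... | false | _ = [] , z≤n , λ a b →
            mk⇔ (λ e → ⊥-elim (false≢true (trans (sym (∧-zeroʳ (adj C _ _))) e))) (λ { (_ , () , _) })


module Recolouring (i : ℕ) (G : Multigraph) (A : Fin (size G) → Bool) (C : Cover G) where

  open InsideA G A

  n : ℕ
  n = size G

  edge : (Fin n → Bool) → Fin n → Fin n → ℕ
  edge φ x y = ind (adj C (x , φ x) (y , φ y))

  weight : Fin n → Fin n → ℕ
  weight x y = if A x then (if A y then 0 else suc i) else (if A y then suc i else 1)

  weighted : (Fin n → Bool) → Fin n → Fin n → ℕ
  weighted φ x y = weight x y * edge φ x y

  cost : (Fin n → Bool) → Fin n → ℕ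
  cost φ v = sumFin n (weighted φ v)

  potential : (Fin n → Bool) → ℕ
  potential φ = total n (weighted φ)

  flip : (Fin n → Bool) → Fin n → Fin n → Bool
  flip φ v = updateAt φ v not

  weighted-sym : ∀ φ x y → weighted φ x y ≡ weighted φ y x
  weighted-sym φ x y = cong₂ _*_ (weight-sym x y) (cong ind (adj-sym C _ _))
    where
      weight-sym : ∀ x y → weight x y ≡ weight y x
      weight-sym x y with A x | A y
      ... | true  | true  = refl
      ... | true  | false = refl
      ... | false | true  = refl
      ... | false | false = refl

  weighted-diag : ∀ φ v → weighted φ v v ≡ 0
  weighted-diag φ v rewrite adj-irr C (v , φ v) = *-zeroʳ (weight v v)

  potential-flip : ∀ φ v →
    potential φ + (cost (flip φ v) v + cost (flip φ v) v) ≡ potential (flip φ v) + (cost φ v + cost φ v)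
  potential-flip φ v = total-change n (weighted φ) (weighted (flip φ v)) v
    (weighted-sym φ) (weighted-sym (flip φ v)) (weighted-diag φ v) (weighted-diag (flip φ v) v)
    (λ x y x≢v y≢v → cong₂ (λ p q → weight x y * ind (adj C (x , p) (y , q)))
      (sym (updateAt-minimal x v φ x≢v)) (sym (updateAt-minimal y v φ y≢v)))

  cost-pair-bound : ∀ φ v → A v ≡ false →
    cost φ v + cost (flip φ v) v ≤ suc i * dIn G A v + dIn G (Complement A) v
  cost-pair-bound φ v v∈B = begin
    cost φ v + cost (flip φ v) v
      ≡⟨ sumFin-+ n (weighted φ v) (weighted (flip φ v) v) ⟨
    sumFin n (λ y → weighted φ v y + weighted (flip φ v) v y)
      ≤⟨ sumFin-mono n pointwise ⟩
    sumFin n (λ y → suc i * (if A y then mult G v y else 0) + (if not (A y) then mult G v y else 0))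
      ≡⟨ sumFin-+ n _ _ ⟩
    sumFin n (λ y → suc i * (if A y then mult G v y else 0)) + dIn G (Complement A) v
      ≡⟨ cong (_+ dIn G (Complement A) v) (sumFin-scale n (suc i) _) ⟨
    suc i * dIn G A v + dIn G (Complement A) v ∎
    where
      open ≤-Reasoning
      weights : ∀ a (e e′ m : ℕ) → e + e′ ≤ m →
        (if a then suc i else 1) * e + (if a then suc i else 1) * e′ ≤
        suc i * (if a then m else 0) + (if not a then m else 0)
      weights true  e e′ m e+e′≤m rewrite +-identityʳ (suc i * m) | sym (*-distribˡ-+ (suc i) e e′) =
        *-monoʳ-≤ (suc i) e+e′≤m
      weights false e e′ m e+e′≤m rewrite *-identityˡ e | *-identityˡ e′ | *-zeroʳ i = e+e′≤m
      pointwise : ∀ y → weighted φ v y + weighted (flip φ v) v y ≤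
        suc i * (if A y then mult G v y else 0) + (if not (A y) then mult G v y else 0)
      pointwise y with y ≟ᶠ v
      ... | yes refl rewrite weighted-diag φ y | weighted-diag (flip φ y) y = z≤n
      ... | no y≢v rewrite v∈B | updateAt-minimal y v {not} φ y≢v | updateAt-updates v {not} φ =
        weights (A y) _ _ _ (fibre-bound C y≢v (φ v) (φ y))

  Agrees : (Fin n → Bool) → (Fin n → Bool) → Set
  Agrees ψ φ = ∀ u → A u ≡ true → φ u ≡ ψ u

  LocallyOptimal : (Fin n → Bool) → Set
  LocallyOptimal φ = ∀ v → A v ≡ false → cost φ v ≤ cost (flip φ v) v

  -- Flip improving vertices of B while possible; the potential bounds the
  -- number of steps.
  local-search : ∀ ψ fuel φ → potential φ < fuel → Agrees ψ φ →
    Σ (Fin n → Bool) λ φ′ → Agrees ψ φ′ × LocallyOptimal φ′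
  local-search ψ zero φ () _
  local-search ψ (suc fuel) φ bound agrees
    with any? (λ v → (A v ≟ᵇ false) ×-dec (cost (flip φ v) v <? cost φ v))
  ... | no stuck = φ , agrees , λ v v∈B → ≮⇒≥ (λ better → stuck (v , v∈B , better))
  ... | yes (v , v∈B , better) =
    local-search ψ fuel (flip φ v) (<-≤-trans (exchange (potential-flip φ v) better) (≤-pred bound))
      (λ u u∈A → trans (updateAt-minimal u v φ (λ { refl → false≢true (trans (sym v∈B) u∈A) })) (agrees u u∈A))

  module Optimum (light : ∀ v → A v ≡ false → suc i * dIn G A v + dIn G (Complement A) v < 2 * i + 2)
                 (ψ : Fin n → Bool) (ψ-colouring : IsColoring i (restrictA C) ψ)
                 (φ : Fin n → Bool) (agrees : Agrees ψ φ) (optimal : LocallyOptimal φ) where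

    -- 2c_φ(v) ≤ c_φ(v) + c_{flip φ v}(v) ≤ (i+1)d_A(v) + d_B(v) ≤ 2i+1.
    cost-small : ∀ v → A v ≡ false → cost φ v ≤ i
    cost-small v v∈B = half i (cost φ v) (≤-<-trans
      (≤-trans (+-monoʳ-≤ (cost φ v) (optimal v v∈B)) (cost-pair-bound φ v v∈B)) (light v v∈B))

    -- No edge of 𝓗_φ joins B to A: it would cost i+1 on its own.
    no-cross-edge : ∀ v y → A v ≡ false → A y ≡ true → edge φ v y ≡ 0
    no-cross-edge v y v∈B y∈A = cheap (adj C (v , φ v) (y , φ y))
      (subst (λ w → w * edge φ v y ≤ i) (weight-cross v∈B y∈A)
        (≤-trans (term≤sumFin n (weighted φ v) y) (cost-small v v∈B)))
      where
        weight-cross : ∀ {v y} → A v ≡ false → A y ≡ true → weight v y ≡ suc i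
        weight-cross v∈B y∈A rewrite v∈B | y∈A = refl
        cheap : ∀ x → suc i * ind x ≤ i → ind x ≡ 0
        cheap false _ = refl
        cheap true  h = ⊥-elim (n≮n i (subst (_≤ i) (*-identityʳ (suc i)) h))

    -- Every weight out of B is at least 1, so degrees in B are at most the cost.
    degree-B : ∀ v → A v ≡ false → degφ C φ v ≤ i
    degree-B v v∈B = ≤-trans (sumFin-mono n edge≤weighted) (cost-small v v∈B)
      where
        edge≤weighted : ∀ y → edge φ v y ≤ weighted φ v y
        edge≤weighted y rewrite v∈B with A y
        ... | true  = m≤n*m _ (suc i)
        ... | false = m≤n*m _ 1

    -- An A-vertex sees no B-vertex and the same A-neighbours as under ψ.
    degree-A : ∀ v → A v ≡ true → degφ C φ v ≤ i
    degree-A v v∈A = ≤-trans (sumFin-mono n edge≤edgeA) (ψ-colouring v)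
      where
        edge≤edgeA : ∀ y → edge φ v y ≤ ind (adjA C (v , ψ v) (y , ψ y))
        edge≤edgeA y with A y in y∈?
        ... | true rewrite agrees v v∈A | agrees y y∈? | v∈A =
              ≤-reflexive (cong ind (sym (∧-identityʳ _)))
        ... | false = subst (_≤ _) (sym (trans (cong ind (adj-sym C _ _)) (no-cross-edge y v y∈? v∈A))) z≤n

    colouring : IsColoring i C φ
    colouring v with A v in v∈?
    ... | true  = degree-A v v∈?
    ... | false = degree-B v v∈?

  recolour : (∀ v → A v ≡ false → suc i * dIn G A v + dIn G (Complement A) v < 2 * i + 2) →
    HasColoring i (restrictA C) → HasColoring i C
  recolour light (ψ , ψ-colouring) with local-search ψ (suc (potential ψ)) ψ ≤-refl (λ _ _ → refl)
  ... | φ , agrees , optimal = φ , Optimum.colouring light ψ ψ-colouring φ agrees optimal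


lemma3p3 : (i : ℕ) → 1 ≤ i → (G : Multigraph) → Critical i G →
    (A : Fin (size G) → Bool) →
    Σ (Fin (size G)) (λ a → A a ≡ true) →
    Σ (Fin (size G)) (λ b → A b ≡ false) →
    Σ (Fin (size G)) (λ v → (A v ≡ false) ×
    ((i + 1) * dIn G A v + dIn G (Complement A) v ≥ 2 * i + 2))
lemma3p3 i _ G ((C , uncolourable) , minimal) A _ (b , b∈B)
  with any? (λ v → (A v ≟ᵇ false) ×-dec (2 * i + 2 ≤? (i + 1) * dIn G A v + dIn G (Complement A) v))
... | yes heavy = heavy
... | no no-heavy = ⊥-elim (uncolourable (Recolouring.recolour i G A C light colourableA))
  where
    open InsideA G A
    light : ∀ v → A v ≡ false → suc i * dIn G A v + dIn G (Complement A) v < 2 * i + 2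
    light v v∈B = subst (λ k → k * dIn G A v + dIn G (Complement A) v < 2 * i + 2) (+-comm i 1)
      (≰⇒> (λ heavy → no-heavy (v , v∈B , heavy)))
    -- b has no edges in G[A], and G[A] inherits minimality from G.
    colourableA : HasColoring i (restrictA C)
    colourableA = colouring-extends G[A] b (outside-isolated b∈B)
      (ProperlyColourable-sub minimal inside) (restrictA C)
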